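{- Let $([n],d)$ be a finite ultrametric space, where $[n]=\{1,\dots,n\}$. Let $\mathrm{OPT}\in[n]$ be a $1$-median, i.e., a point minimizing $\sum_{y\in[n]}d(\cdot,y)$ over $[n]$. Order the points of $[n]$ as $p_1=\mathrm{OPT},p_2,\dots,p_n$ so that $$0=d(\mathrm{OPT},p_1)\le d(\mathrm{OPT},p_2)\le\cdots\le d(\mathrm{OPT},p_n).$$ Then for every $1\le \ell\le n$, $$\sum_{i=1}^n d(p_\ell,p_i)\le\left(1+\frac{\ell-1}{n-\ell+1}\right)\sum_{i=1}^n d(\mathrm{OPT},p_i).$$
   Context: An ultrametric space is a nonempty set $M$ with a function $d\colon M\times M\to[0,\infty)$ such that for all $x,y,z\in M$: $d(x,y)=0$ iff $x=y$; $d(x,y)=d(y,x)$; and $d(x,z)\le\max\{d(x,y),d(y,z)\}$.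
   Formalization: The distances d take values in the nonnegative rationals rather than in $[0,\infty)$. -}

module Defs where

open import Data.Nat as ℕ using (ℕ; zero; suc)
open import Data.Fin using (Fin; zero; suc)
open import Data.Integer using (+_)
open import Data.Rational using (ℚ; 0ℚ; _+_; _≤_; _⊔_; _/_)
open import Data.Product using (_×_)
open import Relation.Binary.PropositionalEquality using (_≡_)
open import Function.Bundles using (_⇔_)

sumFin : ∀ {n} → (Fin n → ℚ) → ℚ
sumFin {zero}  f = 0ℚ
sumFin {suc n} f = f zero + sumFin (λ i → f (suc i))

record IsUltrametric {n : ℕ} (d : Fin n → Fin n → ℚ) : Set where
  field
    nonneg    : ∀ x y → 0ℚ ≤ d x y
    zero-iff  : ∀ x y → (d x y ≡ 0ℚ) ⇔ (x ≡ y)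
    symmetric : ∀ x y → d x y ≡ d y x
    ultra     : ∀ x y z → d x z ≤ (d x y ⊔ d y z)

cost : ∀ {n} → (Fin n → Fin n → ℚ) → Fin n → ℚ
cost d x = sumFin (λ y → d x y)

Is1Median : ∀ {n} → (Fin n → Fin n → ℚ) → Fin n → Set
Is1Median d x = ∀ z → cost d x ≤ cost d z

ratio : ℕ → ℕ → ℚ
ratio a b = (+ a) / suc b

{-# OPTIONS --safe #-}
-- Let D = Σᵢ d(o, xᵢ) and r = d(o, x_ℓ). The ultrametric inequality through the
-- centre o gives d(x_ℓ, xᵢ) ≤ max(r, d(o, xᵢ)), which equals d(o, xᵢ) for i ≥ ℓ and
-- is at most d(o, xᵢ) + r for the ℓ indices i < ℓ; hence the cost of x_ℓ is at most
-- D + ℓ r. The n − ℓ points xᵢ with i ≥ ℓ each lie at distance at least r from o,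
-- so (n − ℓ) r ≤ D, i.e. ℓ r ≤ ℓ/(n − ℓ) · D.
module Submission where

open import Defs
open import Data.Nat as ℕ using (ℕ; suc; _∸_)
open import Data.Fin using (Fin; zero; toℕ) renaming (_≤_ to _≤ᶠ_)
open import Data.Fin.Permutation using (Permutation′; _⟨$⟩ʳ_)
open import Data.Rational using (ℚ; 1ℚ; _+_; _*_; _≤_)
open import Relation.Binary.PropositionalEquality using (_≡_)

open import Algebra.Bundles using (module CommutativeMonoid)
open import Data.Bool using (true; false; if_then_else_)
open import Data.Fin using (suc)
import Data.Fin.Properties as Finₚ
import Data.Integer as ℤ
import Data.Integer.Properties as ℤₚ
import Data.Nat.Properties as ℕₚ
open import Data.Rational using (0ℚ; _⊔_; toℚᵘ)
open import Data.Rational.Literals using (fromℤ)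
open import Data.Rational.Properties
import Data.Rational.Unnormalised as ℚᵘ
import Data.Rational.Unnormalised.Properties as ℚᵘₚ
open import Relation.Nullary.Reflects using (ofⁿ)
open import Relation.Binary.PropositionalEquality using (refl; sym; trans; cong; subst; module ≡-Reasoning)

open import Algebra.Properties.CommutativeSemigroup
  (CommutativeMonoid.commutativeSemigroup +-0-commutativeMonoid) using (interchange)

sumFin-mono-≤ : ∀ {n} {f g : Fin n → ℚ} → (∀ i → f i ≤ g i) → sumFin f ≤ sumFin g
sumFin-mono-≤ {ℕ.zero} f≤g = ≤-refl
sumFin-mono-≤ {suc n}  f≤g = +-mono-≤ (f≤g zero) (sumFin-mono-≤ (λ i → f≤g (suc i)))

sumFin-+ : ∀ {n} (f g : Fin n → ℚ) → sumFin (λ i → f i + g i) ≡ sumFin f + sumFin g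
sumFin-+ {ℕ.zero} f g = refl
sumFin-+ {suc n}  f g =
  trans (cong (f zero + g zero +_) (sumFin-+ (λ i → f (suc i)) (λ i → g (suc i))))
        (interchange (f zero) (g zero) _ _)

-- Via fromℤ rather than _/ 1, so that toℚᵘ (fromℕ n) reduces to mkℚᵘ (+ n) 0.
fromℕ : ℕ → ℚ
fromℕ n = fromℤ (ℤ.+ n)

fromℕ-suc : ∀ n → fromℕ (suc n) ≡ 1ℚ + fromℕ n
fromℕ-suc n = toℚᵘ-injective (begin
  toℚᵘ (fromℕ (suc n))            ≈⟨ ℚᵘ.*≡* (cong (λ t → (ℤ.+ 1 ℤ.+ t) ℤ.* ℤ.+ 1) (sym (ℤₚ.*-identityʳ (ℤ.+ n)))) ⟩
  toℚᵘ 1ℚ ℚᵘ.+ toℚᵘ (fromℕ n)     ≈⟨ toℚᵘ-homo-+ 1ℚ (fromℕ n) ⟨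
  toℚᵘ (1ℚ + fromℕ n)             ∎)
  where open ℚᵘₚ.≃-Reasoning

ratio-*-fromℕ : ∀ a b → ratio a b * fromℕ (suc b) ≡ fromℕ a
ratio-*-fromℕ a b = toℚᵘ-injective (begin
  toℚᵘ (ratio a b * fromℕ (suc b))                   ≈⟨ toℚᵘ-homo-* (ratio a b) (fromℕ (suc b)) ⟩
  toℚᵘ (ratio a b) ℚᵘ.* toℚᵘ (fromℕ (suc b))         ≈⟨ ℚᵘₚ.*-congʳ (toℚᵘ-fromℚᵘ (ℚᵘ.mkℚᵘ (ℤ.+ a) b)) ⟩
  ℚᵘ.mkℚᵘ (ℤ.+ a) b ℚᵘ.* toℚᵘ (fromℕ (suc b))        ≈⟨ ℚᵘ.*≡* (ℤₚ.*-assoc (ℤ.+ a) (ℤ.+ suc b) (ℤ.+ 1)) ⟩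
  toℚᵘ (fromℕ a)                                     ∎)
  where open ℚᵘₚ.≃-Reasoning

fromℕ-suc-* : ∀ n c → fromℕ (suc n) * c ≡ c + fromℕ n * c
fromℕ-suc-* n c = begin
  fromℕ (suc n) * c         ≡⟨ cong (_* c) (fromℕ-suc n) ⟩
  (1ℚ + fromℕ n) * c        ≡⟨ *-distribʳ-+ c 1ℚ (fromℕ n) ⟩
  1ℚ * c + fromℕ n * c      ≡⟨ cong (_+ fromℕ n * c) (*-identityˡ c) ⟩
  c + fromℕ n * c           ∎
  where open ≡-Reasoning

sumFin-const : ∀ n c → sumFin {n} (λ _ → c) ≡ fromℕ n * c
sumFin-const ℕ.zero  c = sym (*-zeroˡ c)
sumFin-const (suc n) c = trans (cong (c +_) (sumFin-const n c)) (sym (fromℕ-suc-* n c))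

step : ℕ → ℚ → ℚ → ∀ {n} → Fin n → ℚ
step L a b i = if toℕ i ℕ.<ᵇ L then a else b

sumFin-step-below : ∀ {n L} c → L ℕ.≤ n → sumFin {n} (step L c 0ℚ) ≡ fromℕ L * c
sumFin-step-below {n} c ℕ.z≤n = trans (sumFin-const n 0ℚ) (trans (*-zeroʳ (fromℕ n)) (sym (*-zeroˡ c)))
sumFin-step-below c (ℕ.s≤s L≤n) = trans (cong (c +_) (sumFin-step-below c L≤n)) (sym (fromℕ-suc-* _ c))

sumFin-step-above : ∀ {n L} c → L ℕ.≤ n → sumFin {n} (step L 0ℚ c) ≡ fromℕ (n ∸ L) * c
sumFin-step-above {n} c ℕ.z≤n = sumFin-const n c
sumFin-step-above c (ℕ.s≤s L≤n) = trans (+-identityˡ _) (sumFin-step-above c L≤n)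

p⊔q≤q+p : ∀ {p q} → 0ℚ ≤ p → 0ℚ ≤ q → p ⊔ q ≤ q + p
p⊔q≤q+p {p} {q} 0≤p 0≤q = ⊔-lub
  (subst (_≤ q + p) (+-identityˡ p) (+-monoˡ-≤ p 0≤q))
  (subst (_≤ q + p) (+-identityʳ q) (+-monoʳ-≤ q 0≤p))

fromℕ-*-≤-ratio-* : ∀ a b {r D} → fromℕ (suc b) * r ≤ D → fromℕ a * r ≤ ratio a b * D
fromℕ-*-≤-ratio-* a b {r} {D} [1+b]r≤D = begin
  fromℕ a * r                       ≡⟨ cong (_* r) (ratio-*-fromℕ a b) ⟨
  ratio a b * fromℕ (suc b) * r     ≡⟨ *-assoc (ratio a b) (fromℕ (suc b)) r ⟩
  ratio a b * (fromℕ (suc b) * r)   ≤⟨ *-monoˡ-≤-nonNeg (ratio a b) {{normalize-nonNeg a (suc b)}} [1+b]r≤D ⟩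
  ratio a b * D                     ∎
  where open ≤-Reasoning

module _ {n} {d : Fin n → Fin n → ℚ} (U : IsUltrametric d) where
  open IsUltrametric U

  ultra-centred : ∀ o x y → d x y ≤ d o x ⊔ d o y
  ultra-centred o x y = subst (λ t → d x y ≤ t ⊔ d o y) (symmetric x o) (ultra x o y)

  module _ (o : Fin n) {k} (x : Fin k → Fin n)
           (sorted : ∀ i j → i ≤ᶠ j → d o (x i) ≤ d o (x j)) (ℓ : Fin k) where

    d[xℓ,·]≤d[o,·]+step : ∀ i → d (x ℓ) (x i) ≤ d o (x i) + step (toℕ ℓ) (d o (x ℓ)) 0ℚ i
    d[xℓ,·]≤d[o,·]+step i with toℕ i ℕ.<ᵇ toℕ ℓ | ℕₚ.<ᵇ-reflects-< (toℕ i) (toℕ ℓ)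
    ... | true  | _       = ≤-trans (ultra-centred o (x ℓ) (x i)) (p⊔q≤q+p (nonneg o (x ℓ)) (nonneg o (x i)))
    ... | false | ofⁿ i≮ℓ = ≤-trans (ultra-centred o (x ℓ) (x i))
                              (≤-reflexive (trans (p≤q⇒p⊔q≡q (sorted ℓ i (ℕₚ.≮⇒≥ i≮ℓ))) (sym (+-identityʳ _))))

    step≤d[o,·] : ∀ i → step (toℕ ℓ) 0ℚ (d o (x ℓ)) i ≤ d o (x i)
    step≤d[o,·] i with toℕ i ℕ.<ᵇ toℕ ℓ | ℕₚ.<ᵇ-reflects-< (toℕ i) (toℕ ℓ)
    ... | true  | _       = nonneg o (x i)
    ... | false | ofⁿ i≮ℓ = sorted ℓ i (ℕₚ.≮⇒≥ i≮ℓ)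

    sumFin-sorted-≤ : sumFin (λ i → d (x ℓ) (x i))
                    ≤ (1ℚ + ratio (toℕ ℓ) (k ∸ suc (toℕ ℓ))) * sumFin (λ i → d o (x i))
    sumFin-sorted-≤ = begin
      sumFin (λ i → d (x ℓ) (x i))               ≤⟨ sumFin-mono-≤ d[xℓ,·]≤d[o,·]+step ⟩
      sumFin (λ i → d o (x i) + step L r 0ℚ i)   ≡⟨ sumFin-+ (λ i → d o (x i)) (step L r 0ℚ) ⟩
      D + sumFin {k} (step L r 0ℚ)               ≡⟨ cong (D +_) (sumFin-step-below r (Finₚ.toℕ≤n ℓ)) ⟩
      D + fromℕ L * r                            ≤⟨ +-monoʳ-≤ D (fromℕ-*-≤-ratio-* L b {r} {D} [1+b]r≤D) ⟩
      D + ratio L b * D                          ≡⟨ cong (_+ ratio L b * D) (*-identityˡ D) ⟨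
      1ℚ * D + ratio L b * D                     ≡⟨ *-distribʳ-+ D 1ℚ (ratio L b) ⟨
      (1ℚ + ratio L b) * D                       ∎
      where
      open ≤-Reasoning
      L = toℕ ℓ
      b = k ∸ suc L
      r = d o (x ℓ)
      D = sumFin (λ i → d o (x i))
      [1+b]r≤D : fromℕ (suc b) * r ≤ D
      [1+b]r≤D = subst (λ t → fromℕ t * r ≤ D) (ℕₚ.+-∸-assoc 1 (Finₚ.toℕ<n ℓ))
                   (subst (_≤ D) (sumFin-step-above r (Finₚ.toℕ≤n ℓ)) (sumFin-mono-≤ step≤d[o,·]))

lemma1 : (m : ℕ) (d : Fin (suc m) → Fin (suc m) → ℚ) → IsUltrametric d →
         (OPT : Fin (suc m)) → Is1Median d OPT →
         (p : Permutation′ (suc m)) →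
         p ⟨$⟩ʳ zero ≡ OPT →
         (∀ i j → i ≤ᶠ j → d OPT (p ⟨$⟩ʳ i) ≤ d OPT (p ⟨$⟩ʳ j)) →
         (ℓ : Fin (suc m)) →
         sumFin (λ i → d (p ⟨$⟩ʳ ℓ) (p ⟨$⟩ʳ i))
           ≤ (1ℚ + ratio (toℕ ℓ) (suc m ∸ suc (toℕ ℓ))) * sumFin (λ i → d OPT (p ⟨$⟩ʳ i))
lemma1 m d U OPT _ p _ sorted ℓ = sumFin-sorted-≤ U OPT (p ⟨$⟩ʳ_) sorted ℓ
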